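{- Let $m\in\mathbb{N}$ and $a_0,a_1,\dots,a_m\in\{0,1\}$, and consider the ex-machine $\mathfrak{Q}(a_0a_1\dots a_m\,x)$ (defined in the context). For every $i$ with $0\le i\le m$: the string $\texttt{a}^i$ is in the language of $\mathfrak{Q}(a_0a_1\dots a_m\,x)$ if $a_i=1$, and $\texttt{a}^i$ is not in its language if $a_i=0$. For every $n>m$, whether $\texttt{a}^n$ is in the language of $\mathfrak{Q}(a_0a_1\dots a_m\,x)$ or not is not yet determined, i.e. it is not fixed by the instructions of $\mathfrak{Q}(a_0a_1\dots a_m\,x)$ but depends on the outcomes of the quantum random bits measured during the execution on input $\texttt{a}^n$.
   Context: Ex-machines. An ex-machine has a finite set of states $Q=\{0,1,\dots,|Q|-1\}\subset\mathbb{N}$ (which may grow during execution), a halting state $h$, a finite alphabet $A$ containing $\texttt{0},\texttt{1}$ and the blank $\texttt{\#}$, a tape $T:\mathbb{Z}\to A$ that is finitely bounded (blank outside a finite set), a tape head position $k\in\mathbb{Z}$, and a finite instruction set $\mathcal{I}$ in which no two instructions share both their first coordinate (state) and second coordinate (scanned symbol). The machine in state $q$ scanning $a=T(k)$ executes the unique instruction with first two coordinates $(q,a)$; it halts when it enters $h$. Instruction types: (1) standard instruction $(q,a,r,\alpha,y)$ with $y\in\{ -1,0,1\}$: set $T(k)=\alpha$, move to state $r$, move the head to $k+y$. (2) quantum random instruction $(q,a,r,y)$: measure a quantum random bit $b\in\{0,1\}$, set $T(k)=b$, move to state $r$, move the head to $k+y$. (3) meta instruction $(q,a,r,\alpha,y,J)$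 with $J$ a standard or quantum random instruction: execute $(q,a,r,\alpha,y)$ as a standard instruction, then if $\mathcal{I}$ contains an instruction with the same first two coordinates as $J$, replace it by $J$, otherwise add $J$ to $\mathcal{I}$. State entries of instructions may be written symbolically as $|Q|$ or $|Q|-1$; when an instruction is executed, all its symbolic entries (including those inside $J$) are instantiated with the current number of states $|Q|$ at the start of that step, and if the target state equals $|Q|$ then the new state $|Q|$ is added to $Q$. An instruction whose first coordinate is the symbol $|Q|-1$ (a simple meta instruction) applies when the machine is in state $|Q|-1$ scanning the given symbol and no instruction with those concrete first two coordinates exists; when executed, its instantiated version is executed and added to $\mathcal{I}$. Quantum random bits are assumed to be independent unbiased Bernoulli trials: each bit is $0$ or $1$ with probability $1/2$, independently of all previous bits. If ex-machine $\mathfrak{X}$ started on some tape halts, the ex-machine with the states and instructions present at the halt is said to be what $\mathfrak{X}$ evolves to; repeating this gives an evolutionary path $\mathfrak{X}_0\to\mathfrak{X}_1\to\cdots$. Languages. Take $A=\{\texttt{\#},\texttt{0},\texttt{1},\texttt{N},\texttt{Y},\texttt{a}\}$. The input tape for $\texttt{a}^n$ ($n\ge0$) has $\texttt{a}$ on squares $1,\dots,n$, blanks elsewhere, head on square $0$, initial state $0$. The string $\texttt{a}^n$ is in the language of an ex-machine $\mathfrak{X}$ if $\mathfrak{X}$ started on this input halts with $\texttt{a}^n$ on squares $1..n$ and $\texttt{Y}$ on square $n+2$; it is not in the language if $\mathfrak{X}$ halts with $\texttt{N}$ on square $n+2$ instead. The machines. Name states $h=1$, $\mathtt{n}=2$,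 $\mathtt{y}=3$, $\mathtt{t}=4$, $\mathtt{v}=5$, $\mathtt{w}=6$, $\mathtt{x}=7$. Let $\mathcal{B}$ be the following 14 instructions: $(0,\#,8,\#,1)$, $(\mathtt{y},\#,h,\texttt{Y},0)$, $(\mathtt{n},\#,h,\texttt{N},0)$, quantum random $(\mathtt{x},\#,\mathtt{x},0)$ and $(\mathtt{x},\texttt{a},\mathtt{t},0)$, meta $(\mathtt{x},\texttt{0},\mathtt{v},\#,0,(|Q|-1,\#,\mathtt{n},\#,1))$, $(\mathtt{x},\texttt{1},\mathtt{w},\#,0,(|Q|-1,\#,\mathtt{y},\#,1))$, $(\mathtt{t},\texttt{0},\mathtt{w},\texttt{a},0,(|Q|-1,\#,\mathtt{n},\#,1))$, $(\mathtt{t},\texttt{1},\mathtt{w},\texttt{a},0,(|Q|-1,\#,\mathtt{y},\#,1))$, $(\mathtt{v},\#,\mathtt{n},\#,1,(|Q|-1,\texttt{a},|Q|,\texttt{a},1))$, $(\mathtt{w},\#,\mathtt{y},\#,1,(|Q|-1,\texttt{a},|Q|,\texttt{a},1))$, $(\mathtt{w},\texttt{a},|Q|,\texttt{a},1,(|Q|-1,\texttt{a},|Q|,\texttt{a},1))$, and simple meta instructions $(|Q|-1,\texttt{a},\mathtt{x},\texttt{a},0)$, $(|Q|-1,\#,\mathtt{x},\#,0)$. The ex-machine $\mathfrak{Q}(x)$ has states $\{0,\dots,8\}$ and instructions $\mathcal{B}\cup\{(8,\#,\mathtt{x},\#,0)\}$. For $a_0,\dots,a_m\in\{0,1\}$,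 $\mathfrak{Q}(a_0\dots a_m\,x)$ has states $\{0,1,\dots,m+9\}$ and instructions $\mathcal{B}$ together with, for each $0\le i\le m$, $(i+8,\#,b_{i+8},\#,1)$ and $(i+8,\texttt{a},i+9,\texttt{a},1)$, where $b_{i+8}=\mathtt{y}$ if $a_i=1$ and $b_{i+8}=\mathtt{n}$ if $a_i=0$. -}

module Defs where

open import Data.Nat using (ℕ; zero; suc; _∸_; _≡ᵇ_; _≤ᵇ_; _+_; _≤_; _<_)
open import Data.Bool using (Bool; true; false; if_then_else_; _∧_; not)
open import Data.Integer using (ℤ; +_; -[1+_]) renaming (_+_ to _+ℤ_; _-_ to _-ℤ_)
open import Data.Integer.Properties using () renaming (_≟_ to _≟ℤ_)
open import Data.List using (List; []; _∷_; _++_; filterᵇ; findᵇ)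
open import Data.Vec using (Vec; []; _∷_)
open import Data.Maybe using (Maybe; just; nothing)
open import Data.Product using (Σ; _×_; _,_)
open import Relation.Nullary using (does)
open import Relation.Binary.PropositionalEquality using (_≡_)

data Sym : Set where
  ♯ 𝟎 𝟏 𝐍 𝐘 𝐚 : Sym

symCode : Sym → ℕ
symCode ♯ = 0
symCode 𝟎 = 1
symCode 𝟏 = 2
symCode 𝐍 = 3
symCode 𝐘 = 4
symCode 𝐚 = 5

_==S_ : Sym → Sym → Bool
s ==S t = symCode s ≡ᵇ symCode t

bitSym : Bool → Sym
bitSym false = 𝟎
bitSym true  = 𝟏

data SE : Set where
  lit   : ℕ → SE
  ∣Q∣   : SE
  ∣Q∣-1 : SE

inst : ℕ → SE → SE
inst nQ (lit q) = lit q
inst nQ ∣Q∣     = lit nQ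
inst nQ ∣Q∣-1   = lit (nQ ∸ 1)

val : ℕ → SE → ℕ
val nQ (lit q) = q
val nQ ∣Q∣     = nQ
val nQ ∣Q∣-1   = nQ ∸ 1

data Move : Set where
  L S R : Move

moveBy : Move → ℤ → ℤ
moveBy L k = k -ℤ + 1
moveBy S k = k
moveBy R k = k +ℤ + 1

data Basic : Set where
  std : SE → Sym → SE → Sym → Move → Basic
  qr  : SE → Sym → SE → Move → Basic

data Instr : Set where
  basic : Basic → Instr
  meta  : SE → Sym → SE → Sym → Move → Basic → Instr

instB : ℕ → Basic → Basic
instB n (std q a r α y) = std (inst n q) a (inst n r) α y
instB n (qr q a r y)    = qr (inst n q) a (inst n r) y

instI : ℕ → Instr → Instr
instI n (basic b)            = basic (instB n b)
instI n (meta q a r α y J)   = meta (inst n q) a (inst n r) α y (instB n J)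

headB : Basic → SE × Sym
headB (std q a _ _ _) = q , a
headB (qr q a _ _)    = q , a

headI : Instr → SE × Sym
headI (basic b)          = headB b
headI (meta q a _ _ _ _) = q , a

concreteMatch : ℕ → Sym → Instr → Bool
concreteMatch q a i with headI i
... | lit p , b = (p ≡ᵇ q) ∧ (b ==S a)
... | _ , _     = false

symbolicMatch : ℕ → ℕ → Sym → Instr → Bool
symbolicMatch nQ q a i with headI i
... | lit _ , _ = false
... | s , b     = (val nQ s ≡ᵇ q) ∧ (b ==S a)

record Config : Set where
  field
    nQ   : ℕ              -- |Q|, states are {0, …, nQ-1}
    prog : List Instr
    st   : ℕ
    tape : ℤ → Sym
    pos  : ℤ
    used : ℕ              -- number of quantum random bits consumed so far
open Config public

record ExMachine : Set where
  field
    states : ℕ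
    instrs : List Instr
open ExMachine public

-- perform the standard part: write α, go to state r, move head by y;
-- add the new state |Q| if r = |Q| (n0 = |Q| at the start of the step)
doStd : ℕ → ℕ → Sym → Move → Config → Config
doStd n0 r α y c = record c
  { st   = r
  ; tape = λ j → if does (j ≟ℤ pos c) then α else tape c j
  ; pos  = moveBy y (pos c)
  ; nQ   = if r ≡ᵇ n0 then suc n0 else n0
  }

-- replace the instruction with the same first two coordinates as J by J,
-- or add J (J is already instantiated)
installJ : ℕ → Basic → List Instr → List Instr
installJ n0 J ps with headB J
... | q , a = filterᵇ (λ i → not (concreteMatch (val n0 q) a i)) ps ++ (basic J ∷ [])

exec : ℕ → (ℕ → Bool) → Instr → Config → Config
exec n0 bits (basic (std q a r α y)) c = doStd n0 (val n0 r) α y c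
exec n0 bits (basic (qr q a r y)) c =
  doStd n0 (val n0 r) (bitSym (bits (used c))) y (record c { used = suc (used c) })
exec n0 bits (meta q a r α y J) c =
  let c' = doStd n0 (val n0 r) α y c
  in record c' { prog = installJ n0 (instB n0 J) (prog c') }

-- one computation step; bits n is the n-th quantum random bit measured
step : (ℕ → Bool) → Config → Maybe Config
step bits c with findᵇ (concreteMatch (st c) (tape c (pos c))) (prog c)
... | just i = just (exec (nQ c) bits i c)
... | nothing with findᵇ (symbolicMatch (nQ c) (st c) (tape c (pos c))) (prog c)
...   | just i =
          let i' = instI (nQ c) i
              c' = exec (nQ c) bits i' c
          in just (record c' { prog = prog c' ++ (i' ∷ []) })
...   | nothing = nothing

hState : ℕ
hState = 1

run : ℕ → (ℕ → Bool) → Config → Maybe Config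
run zero     bits c = nothing
run (suc f) bits c with step bits c
... | nothing = nothing
... | just c' = if st c' ≡ᵇ hState then just c' else run f bits c'

inputTape : ℕ → ℤ → Sym
inputTape n (+ k)    = if (1 ≤ᵇ k) ∧ (k ≤ᵇ n) then 𝐚 else ♯
inputTape n -[1+ k ] = ♯

initial : ExMachine → ℕ → Config
initial X n = record
  { nQ = states X ; prog = instrs X ; st = 0
  ; tape = inputTape n ; pos = + 0 ; used = 0 }

HaltsIn : ExMachine → ℕ → (ℕ → Bool) → Config → Set
HaltsIn X n bits c = Σ ℕ λ fuel → run fuel bits (initial X n) ≡ just c

HaltsWith : Sym → ExMachine → ℕ → (ℕ → Bool) → Set
HaltsWith s X n bits = Σ Config λ c → HaltsIn X n bits c
  × ((k : ℕ) → 1 ≤ k → k ≤ n → tape c (+ k) ≡ 𝐚)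
  × tape c (+ (n + 2)) ≡ s

InLanguage : ExMachine → ℕ → (ℕ → Bool) → Set
InLanguage = HaltsWith 𝐘

NotInLanguage : ExMachine → ℕ → (ℕ → Bool) → Set
NotInLanguage = HaltsWith 𝐍

sn sy st' sv sw sx : ℕ
sn = 2
sy = 3
st' = 4
sv = 5
sw = 6
sx = 7

𝓑 : List Instr
𝓑 =
    basic (std (lit 0) ♯ (lit 8) ♯ R)
  ∷ basic (std (lit sy) ♯ (lit hState) 𝐘 S)
  ∷ basic (std (lit sn) ♯ (lit hState) 𝐍 S)
  ∷ basic (qr (lit sx) ♯ (lit sx) S)
  ∷ basic (qr (lit sx) 𝐚 (lit st') S)
  ∷ meta (lit sx) 𝟎 (lit sv) ♯ S (std ∣Q∣-1 ♯ (lit sn) ♯ R)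
  ∷ meta (lit sx) 𝟏 (lit sw) ♯ S (std ∣Q∣-1 ♯ (lit sy) ♯ R)
  ∷ meta (lit st') 𝟎 (lit sw) 𝐚 S (std ∣Q∣-1 ♯ (lit sn) ♯ R)
  ∷ meta (lit st') 𝟏 (lit sw) 𝐚 S (std ∣Q∣-1 ♯ (lit sy) ♯ R)
  ∷ meta (lit sv) ♯ (lit sn) ♯ R (std ∣Q∣-1 𝐚 ∣Q∣ 𝐚 R)
  ∷ meta (lit sw) ♯ (lit sy) ♯ R (std ∣Q∣-1 𝐚 ∣Q∣ 𝐚 R)
  ∷ meta (lit sw) 𝐚 ∣Q∣ 𝐚 R (std ∣Q∣-1 𝐚 ∣Q∣ 𝐚 R)
  ∷ basic (std ∣Q∣-1 𝐚 (lit sx) 𝐚 S)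
  ∷ basic (std ∣Q∣-1 ♯ (lit sx) ♯ S)
  ∷ []

bitInstrs : ℕ → Bool → List Instr
bitInstrs i b =
    basic (std (lit (i + 8)) ♯ (lit (if b then sy else sn)) ♯ R)
  ∷ basic (std (lit (i + 8)) 𝐚 (lit (i + 9)) 𝐚 R)
  ∷ []

prefixInstrs : ℕ → {m : ℕ} → Vec Bool m → List Instr
prefixInstrs i []       = []
prefixInstrs i (b ∷ bs) = bitInstrs i b ++ prefixInstrs (suc i) bs

𝔔 : (m : ℕ) → Vec Bool (suc m) → ExMachine
𝔔 m as = record { states = m + 10 ; instrs = 𝓑 ++ prefixInstrs 0 as }

module Submission where

-- The run on aⁿ has two phases.  In the prefix phase the machine starts in
-- state 8 on square 1 and, for j = 0, 1, …, uses the instructions of state 8 + j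
-- stored in 𝔔 (copy 𝐚, go to state 9 + j).  If n ≤ m it reaches the blank on
-- square n + 1 in state 8 + n, whose stored instruction leads to the verdict
-- state y or n dictated by aₙ, which writes Y or N on square n + 2; this is
-- independent of the random bits.  If n > m it reaches state 9 + m = |Q| - 1,
-- where the simple meta instructions take over: on every remaining 𝐚 a random
-- bit is measured (and recorded as a new instruction), a new state is created,
-- and on the final blank one more bit decides between N and Y.  Feeding the
-- constant bit stream b therefore produces Y for b = true and N for b = false.

open import Defs
open import Data.Nat using (ℕ; zero; suc; _<_; _≤_; _+_; _∸_; _≡ᵇ_; _<ᵇ_; _≤ᵇ_; z≤n; s≤s; z<s; s<s⁻¹)
import Data.Nat.Properties as NP
open import Data.Bool using (Bool; true; false; if_then_else_; _∧_; not; T)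
open import Data.Bool.Properties using (∧-zeroʳ)
open import Data.Fin using (Fin; toℕ) renaming (zero to fzero; suc to fsuc)
import Data.Fin.Properties as FinP
open import Data.Vec using (Vec; lookup; []; _∷_)
open import Data.List using (List; []; _∷_; _++_; filterᵇ; findᵇ)
open import Data.Maybe using (Maybe; just; nothing)
open import Data.Product using (Σ; _×_; _,_; proj₁)
open import Data.Integer using (ℤ; +_)
open import Data.Integer.Properties using () renaming (_≟_ to _≟ℤ_)
open import Data.Empty using (⊥-elim)
open import Relation.Nullary using (does; yes; no)
open import Relation.Binary.PropositionalEquality

≡ᵇ-refl : ∀ n → (n ≡ᵇ n) ≡ true
≡ᵇ-refl zero    = refl
≡ᵇ-refl (suc n) = ≡ᵇ-refl n

≢⇒≡ᵇ-false : ∀ {m n} → m ≢ n → (m ≡ᵇ n) ≡ false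
≢⇒≡ᵇ-false {m} {n} m≢n with m ≡ᵇ n | NP.≡ᵇ⇒≡ m n
... | true  | sound = ⊥-elim (m≢n (sound _))
... | false | _     = refl

≡ᵇ-true⇒≡ : ∀ {m n} → (m ≡ᵇ n) ≡ true → m ≡ n
≡ᵇ-true⇒≡ {m} {n} e = NP.≡ᵇ⇒≡ m n (subst T (sym e) _)

if-true : ∀ {A : Set} {b} {x y : A} → b ≡ true → (if b then x else y) ≡ x
if-true refl = refl

if-false : ∀ {A : Set} {b} {x y : A} → b ≡ false → (if b then x else y) ≡ y
if-false refl = refl

lit<8 : ∀ q → T (q <ᵇ 8) → q < 8
lit<8 q = NP.<ᵇ⇒< q 8

-- Downward induction: a property of every j ≤ e follows from the property at e
-- and the step from j + 1 back to j.  Both phases of the run are sweeps of this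
-- kind over the squares of the input.
descend : ∀ (P : ℕ → Set) {e} → (∀ j → j < e → P (suc j) → P j) → P e
  → ∀ j → j ≤ e → P j
descend P {e} back top j j≤e = sweep (e ∸ j) j (NP.m+[n∸m]≡n j≤e)
  where
  sweep : ∀ d j → j + d ≡ e → P j
  sweep zero    j eq = subst P (sym (trans (sym (NP.+-identityʳ j)) eq)) top
  sweep (suc d) j eq =
    back j (subst (j <_) eq (NP.m<m+n j z<s)) (sweep d (suc j) (trans (sym (NP.+-suc j d)) eq))

module _ {A : Set} where

  findᵇ-skip : ∀ (P : A → Bool) {x} xs → P x ≡ false → findᵇ P (x ∷ xs) ≡ findᵇ P xs
  findᵇ-skip P {x} xs e with P x
  findᵇ-skip P {x} xs refl | .false = refl

  findᵇ-++-just : ∀ (P : A → Bool) xs ys {y} → findᵇ P xs ≡ just y → findᵇ P (xs ++ ys) ≡ just y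
  findᵇ-++-just P (x ∷ xs) ys e with P x
  ... | true  = e
  ... | false = findᵇ-++-just P xs ys e

  findᵇ-++-left : ∀ (P : A → Bool) xs ys → findᵇ P xs ≡ nothing → findᵇ P (xs ++ ys) ≡ findᵇ P ys
  findᵇ-++-left P []       ys e = refl
  findᵇ-++-left P (x ∷ xs) ys e with P x
  findᵇ-++-left P (x ∷ xs) ys () | true
  ... | false = findᵇ-++-left P xs ys e

  findᵇ-++-right : ∀ (P : A → Bool) xs ys → findᵇ P ys ≡ nothing → findᵇ P (xs ++ ys) ≡ findᵇ P xs
  findᵇ-++-right P []       ys e = e
  findᵇ-++-right P (x ∷ xs) ys e with P x
  ... | true  = refl
  ... | false = findᵇ-++-right P xs ys e

  findᵇ-filterᵇ : ∀ (P Q : A → Bool) → (∀ x → P x ≡ true → Q x ≡ true) → ∀ xs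
    → findᵇ P (filterᵇ Q xs) ≡ findᵇ P xs
  findᵇ-filterᵇ P Q keeps [] = refl
  findᵇ-filterᵇ P Q keeps (x ∷ xs) with Q x in qx
  ... | true with P x
  ...   | true  = refl
  ...   | false = findᵇ-filterᵇ P Q keeps xs
  findᵇ-filterᵇ P Q keeps (x ∷ xs) | false with P x in px
  ...   | true with () ← trans (sym (keeps x px)) qx
  ...   | false = findᵇ-filterᵇ P Q keeps xs

lookupC : ℕ → Sym → List Instr → Maybe Instr
lookupC q s = findᵇ (concreteMatch q s)

lookupS : ℕ → ℕ → Sym → List Instr → Maybe Instr
lookupS N q s = findᵇ (symbolicMatch N q s)

lit-injective : ∀ {a b} → lit a ≡ lit b → a ≡ b
lit-injective refl = refl

concrete-head : ∀ q s x → concreteMatch q s x ≡ true → proj₁ (headI x) ≡ lit q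
concrete-head q s x e with headI x
... | lit p , b = cong lit (≡ᵇ-true⇒≡ (first e))
  where first : ∀ {u v} → u ∧ v ≡ true → u ≡ true
        first {true} _ = refl
concrete-head q s x () | ∣Q∣ , b
concrete-head q s x () | ∣Q∣-1 , b

symbolic-head : ∀ N q s x p → symbolicMatch N q s x ≡ true → proj₁ (headI x) ≢ lit p
symbolic-head N q s x p e with headI x
symbolic-head N q s x p () | lit p' , b
... | ∣Q∣ , b   = λ ()
... | ∣Q∣-1 , b = λ ()

concrete-other : ∀ {q₀} q s x → proj₁ (headI x) ≡ lit q₀ → q₀ ≢ q → concreteMatch q s x ≡ false
concrete-other q s x h q₀≢q with concreteMatch q s x in e
... | true  = ⊥-elim (q₀≢q (lit-injective (trans (sym h) (concrete-head q s x e))))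
... | false = refl

symbolic-other : ∀ {q₀} N q s x → proj₁ (headI x) ≡ lit q₀ → symbolicMatch N q s x ≡ false
symbolic-other N q s x h with symbolicMatch N q s x in e
... | true  = ⊥-elim (symbolic-head N q s x _ e h)
... | false = refl

write : (ℤ → Sym) → ℤ → Sym → ℤ → Sym
write T p α j = if does (j ≟ℤ p) then α else T j

write-here : ∀ T p α → write T p α p ≡ α
write-here T p α with p ≟ℤ p
... | yes _   = refl
... | no p≢p = ⊥-elim (p≢p refl)

write-elsewhere : ∀ T p α j → j ≢ p → write T p α j ≡ T j
write-elsewhere T p α j j≢p with j ≟ℤ p
... | yes j≡p = ⊥-elim (j≢p j≡p)
... | no _    = refl

≤⇒≤ᵇ-true : ∀ {m n} → m ≤ n → (m ≤ᵇ n) ≡ true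
≤⇒≤ᵇ-true {m} {n} m≤n with m ≤ᵇ n | NP.≤⇒≤ᵇ m≤n
... | true | _ = refl

>⇒≤ᵇ-false : ∀ {m n} → n < m → (m ≤ᵇ n) ≡ false
>⇒≤ᵇ-false {m} {n} n<m with m ≤ᵇ n | NP.≤ᵇ⇒≤ m n
... | true  | sound = ⊥-elim (NP.<⇒≱ n<m (sound _))
... | false | _     = refl

input-letter : ∀ n k → 1 ≤ k → k ≤ n → inputTape n (+ k) ≡ 𝐚
input-letter n k 1≤k k≤n rewrite ≤⇒≤ᵇ-true 1≤k | ≤⇒≤ᵇ-true k≤n = refl

input-blank : ∀ n k → n < k → inputTape n (+ k) ≡ ♯
input-blank n k n<k rewrite >⇒≤ᵇ-false n<k | ∧-zeroʳ (1 ≤ᵇ k) = refl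

-- The tape still holds the input aⁿ: the machine only rewrites squares with
-- the symbol they already carry, apart from the transient random bits.
AgreesWithInput : ℕ → (ℤ → Sym) → Set
AgreesWithInput n T = ∀ j → T j ≡ inputTape n j

agree-write : ∀ {n T} p α → AgreesWithInput n T → inputTape n p ≡ α
  → AgreesWithInput n (write T p α)
agree-write {n} {T} p α agree e j with j ≟ℤ p
... | yes refl = sym e
... | no _     = agree j

-- a random bit written on a square is erased by restoring the input symbol
agree-overwrite : ∀ {n T} p β α → AgreesWithInput n T → inputTape n p ≡ α
  → AgreesWithInput n (write (write T p β) p α)
agree-overwrite {n} {T} p β α agree e j with j ≟ℤ p
... | yes refl = sym e
... | no _     = agree j

config : ℕ → List Instr → ℕ → (ℤ → Sym) → ℤ → ℕ → Config
config N p q T k u = record { nQ = N ; prog = p ; st = q ; tape = T ; pos = k ; used = u }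

Halts : (ℕ → Bool) → Config → (Config → Set) → Set
Halts bits c Q = Σ ℕ λ fuel → Σ Config λ c' → run fuel bits c ≡ just c' × Q c'

halts-after-step : ∀ {bits c c' Q} → step bits c ≡ just c' → (st c' ≡ᵇ hState) ≡ false
  → Halts bits c' Q → Halts bits c Q
halts-after-step {bits} {c} {c'} stepped e (fuel , d , ran , q) = suc fuel , d , reduce stepped e , q
  where
  reduce : step bits c ≡ just c' → (st c' ≡ᵇ hState) ≡ false → run (suc fuel) bits c ≡ just d
  reduce stepped e with step bits c
  reduce refl e | just .c' rewrite e = ran

halts-at-step : ∀ {bits c c' Q} → step bits c ≡ just c' → (st c' ≡ᵇ hState) ≡ true
  → Q c' → Halts bits c Q
halts-at-step {bits} {c} {c'} stepped e q = 1 , c' , reduce stepped e , q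
  where
  reduce : step bits c ≡ just c' → (st c' ≡ᵇ hState) ≡ true → run 1 bits c ≡ just c'
  reduce stepped e with step bits c
  reduce refl e | just .c' rewrite e = refl

step-concrete : ∀ bits c s i → tape c (pos c) ≡ s → lookupC (st c) s (prog c) ≡ just i
  → step bits c ≡ just (exec (nQ c) bits i c)
step-concrete bits c s i refl found with findᵇ (concreteMatch (st c) (tape c (pos c))) (prog c)
step-concrete bits c s i refl refl | just .i = refl

step-symbolic : ∀ bits c s i → tape c (pos c) ≡ s → lookupC (st c) s (prog c) ≡ nothing
  → lookupS (nQ c) (st c) s (prog c) ≡ just i
  → step bits c ≡ just (let c' = exec (nQ c) bits (instI (nQ c) i) c
                        in record c' { prog = prog c' ++ (instI (nQ c) i ∷ []) })
step-symbolic bits c s i refl none found with findᵇ (concreteMatch (st c) (tape c (pos c))) (prog c)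
step-symbolic bits c s i refl refl found | nothing
  with findᵇ (symbolicMatch (nQ c) (st c) (tape c (pos c))) (prog c)
step-symbolic bits c s i refl refl refl | nothing | just .i = refl

halts-cong : ∀ {bits Q} (c : Config) {N q k} → nQ c ≡ N → st c ≡ q → pos c ≡ k
  → Halts bits (config N (prog c) q (tape c) k (used c)) Q → Halts bits c Q
halts-cong c refl refl refl h = h

Output : ℕ → Sym → Config → Set
Output n s c = ((k : ℕ) → 1 ≤ k → k ≤ n → tape c (+ k) ≡ 𝐚) × tape c (+ (n + 2)) ≡ s

output-written : ∀ n s T → AgreesWithInput n T
  → ∀ N p q k u → Output n s (config N p q (write T (+ (suc n + 1)) s) k u)
output-written n s T agree N p q k u = letters , verdict-square
  where
  letters : ∀ j → 1 ≤ j → j ≤ n → write T (+ (suc n + 1)) s (+ j) ≡ 𝐚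
  letters j 1≤j j≤n =
    trans (write-elsewhere T (+ (suc n + 1)) s (+ j) (λ { refl → NP.<⇒≱ (s≤s (NP.m≤m+n n 1)) j≤n }))
          (trans (agree (+ j)) (input-letter n j 1≤j j≤n))
  verdict-square : write T (+ (suc n + 1)) s (+ (n + 2)) ≡ s
  verdict-square = trans (cong (λ k → write T (+ (suc n + 1)) s (+ k)) (NP.+-suc n 1))
                         (write-here T _ s)

halts-with : ∀ {s X n bits} → Halts bits (initial X n) (Output n s) → HaltsWith s X n bits
halts-with (fuel , c , ran , letters , verdict-square) = c , (fuel , ran) , letters , verdict-square

𝓑-silent : ∀ t s → lookupC (8 + t) s 𝓑 ≡ nothing
𝓑-silent t ♯ = refl
𝓑-silent t 𝟎 = refl
𝓑-silent t 𝟏 = refl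
𝓑-silent t 𝐍 = refl
𝓑-silent t 𝐘 = refl
𝓑-silent t 𝐚 = refl

-- in the last state |Q| - 1 the simple meta instructions pass control to x
𝓑-simple-letter : ∀ r → lookupS (9 + r) (8 + r) 𝐚 𝓑 ≡ just (basic (std ∣Q∣-1 𝐚 (lit sx) 𝐚 S))
𝓑-simple-letter r rewrite ≡ᵇ-refl r = refl

𝓑-simple-blank : ∀ r → lookupS (9 + r) (8 + r) ♯ 𝓑 ≡ just (basic (std ∣Q∣-1 ♯ (lit sx) ♯ S))
𝓑-simple-blank r rewrite ≡ᵇ-refl r = refl

verdict : Bool → ℕ
verdict b = if b then sy else sn

verdictSym : Bool → Sym
verdictSym b = if b then 𝐘 else 𝐍

-- in state t the random bit b just written selects the verdict to be stored
𝓑-t-on-bit : ∀ b → lookupC st' (bitSym b) 𝓑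
  ≡ just (meta (lit st') (bitSym b) (lit sw) 𝐚 S (std ∣Q∣-1 ♯ (lit (verdict b)) ♯ R))
𝓑-t-on-bit false = refl
𝓑-t-on-bit true  = refl

initialProgram : ∀ {l} → Vec Bool l → List Instr
initialProgram as = 𝓑 ++ prefixInstrs 0 as

prefix-match : ∀ k q s′ s r α y
  → concreteMatch (8 + q) s (basic (std (lit (k + 8)) s′ r α y)) ≡ (k ≡ᵇ q) ∧ (s′ ==S s)
prefix-match k q s′ s r α y rewrite NP.+-comm k 8 = refl

prefix-skip : ∀ (P : Instr → Bool) k b {l} (bs : Vec Bool l)
  → P (basic (std (lit (k + 8)) ♯ (lit (verdict b)) ♯ R)) ≡ false
  → P (basic (std (lit (k + 8)) 𝐚 (lit (k + 9)) 𝐚 R)) ≡ false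
  → findᵇ P (prefixInstrs k (b ∷ bs)) ≡ findᵇ P (prefixInstrs (suc k) bs)
prefix-skip P k b bs blank letter rewrite blank | letter = refl

prefix-pass : ∀ k b {l} (bs : Vec Bool l) q s → k ≢ q
  → lookupC (8 + q) s (prefixInstrs k (b ∷ bs)) ≡ lookupC (8 + q) s (prefixInstrs (suc k) bs)
prefix-pass k b bs q s k≢q = prefix-skip (concreteMatch (8 + q) s) k b bs
  (trans (prefix-match k q ♯ s (lit (verdict b)) ♯ R) (cong (_∧ (♯ ==S s)) (≢⇒≡ᵇ-false k≢q)))
  (trans (prefix-match k q 𝐚 s (lit (k + 9)) 𝐚 R) (cong (_∧ (𝐚 ==S s)) (≢⇒≡ᵇ-false k≢q)))

prefix-beyond : ∀ k {l} (bs : Vec Bool l) q s → k + l ≤ q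
  → lookupC (8 + q) s (prefixInstrs k bs) ≡ nothing
prefix-beyond k []       q s _ = refl
prefix-beyond k {suc l} (b ∷ bs) q s k+l<q =
  trans (prefix-pass k b bs q s (NP.<⇒≢ (NP.<-≤-trans (NP.m<m+n k z<s) k+l<q)))
        (prefix-beyond (suc k) bs q s (subst (_≤ q) (NP.+-suc k l) k+l<q))

prefix-below-8 : ∀ k {l} (bs : Vec Bool l) q s → q < 8 → lookupC q s (prefixInstrs k bs) ≡ nothing
prefix-below-8 k []       q s q<8 = refl
prefix-below-8 k (b ∷ bs) q s q<8 =
  trans (prefix-skip (concreteMatch q s) k b bs
           (concrete-other q s (basic (std (lit (k + 8)) ♯ (lit (verdict b)) ♯ R)) refl k+8≢q)
           (concrete-other q s (basic (std (lit (k + 8)) 𝐚 (lit (k + 9)) 𝐚 R)) refl k+8≢q))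
        (prefix-below-8 (suc k) bs q s q<8)
  where k+8≢q : k + 8 ≢ q
        k+8≢q e = NP.<⇒≢ (NP.<-≤-trans q<8 (NP.m≤n+m 8 k)) (sym e)

prefix-symbolic : ∀ k {l} (bs : Vec Bool l) N q s → lookupS N q s (prefixInstrs k bs) ≡ nothing
prefix-symbolic k []       N q s = refl
prefix-symbolic k (b ∷ bs) N q s = prefix-symbolic (suc k) bs N q s

prefix-letter : ∀ k {l} (bs : Vec Bool l) j → j < l
  → lookupC (8 + (k + j)) 𝐚 (prefixInstrs k bs)
    ≡ just (basic (std (lit (k + j + 8)) 𝐚 (lit (9 + (k + j))) 𝐚 R))
prefix-letter k (b ∷ bs) zero _
  rewrite NP.+-identityʳ k
        | prefix-match k k ♯ 𝐚 (lit (verdict b)) ♯ R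
        | prefix-match k k 𝐚 𝐚 (lit (k + 9)) 𝐚 R
        | ≡ᵇ-refl k
        | NP.+-comm k 9 = refl
prefix-letter k (b ∷ bs) (suc j) j<l rewrite NP.+-suc k j =
  trans (prefix-pass k b bs (suc (k + j)) 𝐚 (NP.<⇒≢ (s≤s (NP.m≤m+n k j))))
        (prefix-letter (suc k) bs j (s<s⁻¹ j<l))

prefix-blank : ∀ k {l} (bs : Vec Bool l) (i : Fin l) b → lookup bs i ≡ b
  → lookupC (8 + (k + toℕ i)) ♯ (prefixInstrs k bs)
    ≡ just (basic (std (lit (k + toℕ i + 8)) ♯ (lit (verdict b)) ♯ R))
prefix-blank k (b ∷ bs) fzero .b refl
  rewrite NP.+-identityʳ k
        | prefix-match k k ♯ ♯ (lit (verdict b)) ♯ R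
        | ≡ᵇ-refl k = refl
prefix-blank k (b ∷ bs) (fsuc i) b′ e rewrite NP.+-suc k (toℕ i) =
  trans (prefix-pass k b bs (suc (k + toℕ i)) ♯ (NP.<⇒≢ (s≤s (NP.m≤m+n k (toℕ i)))))
        (prefix-blank (suc k) bs i b′ e)

-- During the run the program is 𝓑 plus instructions for the
-- states 8, 9, …; `Tidy r p` says that it still behaves like 𝓑 on the states
-- below 8 and on symbolic lookups, and has nothing yet for the states ≥ 8 + r,
-- so that in state 8 + r = |Q| - 1 the simple meta instructions apply.

record Tidy (r : ℕ) (p : List Instr) : Set where
  field
    below    : ∀ q s → q < 8 → lookupC q s p ≡ lookupC q s 𝓑
    above    : ∀ t s → r ≤ t → lookupC (8 + t) s p ≡ nothing
    symbolic : ∀ N q s → lookupS N q s p ≡ lookupS N q s 𝓑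
open Tidy

tidy-initial : ∀ {m} (as : Vec Bool (suc m)) → Tidy (suc m) (initialProgram as)
tidy-initial as .below q s q<8 with lookupC q s 𝓑 in found
... | just _  = findᵇ-++-just (concreteMatch q s) 𝓑 (prefixInstrs 0 as) found
... | nothing = trans (findᵇ-++-left (concreteMatch q s) 𝓑 (prefixInstrs 0 as) found)
                      (prefix-below-8 0 as q s q<8)
tidy-initial as .above t s m<t =
  trans (findᵇ-++-left (concreteMatch (8 + t) s) 𝓑 (prefixInstrs 0 as) (𝓑-silent t s))
        (prefix-beyond 0 as t s m<t)
tidy-initial as .symbolic N q s =
  findᵇ-++-right (symbolicMatch N q s) 𝓑 (prefixInstrs 0 as) (prefix-symbolic 0 as N q s)

tidy-weaken : ∀ {r p} → Tidy r p → Tidy (suc r) p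
tidy-weaken tidy .below    = tidy .below
tidy-weaken tidy .above t s r<t = tidy .above t s (NP.<⇒≤ r<t)
tidy-weaken tidy .symbolic = tidy .symbolic

tidy-append : ∀ {r p} x → proj₁ (headI x) ≡ lit (8 + r) → Tidy (suc r) p → Tidy (suc r) (p ++ x ∷ [])
tidy-append {r} {p} x head tidy .below q s q<8 =
  trans (findᵇ-++-right (concreteMatch q s) p _ (findᵇ-skip (concreteMatch q s) [] (concrete-other q s x head 8+r≢q)))
        (tidy .below q s q<8)
  where 8+r≢q : 8 + r ≢ q
        8+r≢q e = NP.<⇒≢ (NP.<-≤-trans q<8 (NP.m≤m+n 8 r)) (sym e)
tidy-append {r} {p} x head tidy .above t s r<t =
  trans (findᵇ-++-right (concreteMatch (8 + t) s) p _
          (findᵇ-skip (concreteMatch (8 + t) s) [] (concrete-other (8 + t) s x head (NP.<⇒≢ (NP.+-monoʳ-≤ 8 r<t)))))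
        (tidy .above t s r<t)
tidy-append {p = p} x head tidy .symbolic N q s =
  trans (findᵇ-++-right (symbolicMatch N q s) p _ (findᵇ-skip (symbolicMatch N q s) [] (symbolic-other N q s x head)))
        (tidy .symbolic N q s)

tidy-filter : ∀ {r p} (keep : Instr → Bool) → (∀ x → keep x ≡ false → proj₁ (headI x) ≡ lit (8 + r))
  → Tidy (suc r) p → Tidy (suc r) (filterᵇ keep p)
tidy-filter {r} {p} keep removed tidy = record
  { below    = λ q s q<8 → trans (findᵇ-filterᵇ (concreteMatch q s) keep
                 (kept (concreteMatch q s) (λ x hit h → NP.<⇒≢ (NP.<-≤-trans q<8 (NP.m≤m+n 8 r))
                   (lit-injective (trans (sym (concrete-head q s x hit)) h)))) p) (tidy .below q s q<8)
  ; above    = λ t s r<t → trans (findᵇ-filterᵇ (concreteMatch (8 + t) s) keep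
                 (kept (concreteMatch (8 + t) s) (λ x hit h → NP.<⇒≢ (NP.+-monoʳ-≤ 8 r<t)
                   (sym (lit-injective (trans (sym (concrete-head (8 + t) s x hit)) h))))) p) (tidy .above t s r<t)
  ; symbolic = λ N q s → trans (findᵇ-filterᵇ (symbolicMatch N q s) keep
                 (kept (symbolicMatch N q s) (λ x hit → symbolic-head N q s x (8 + r) hit)) p) (tidy .symbolic N q s)
  }
  where
  kept : ∀ (hit : Instr → Bool) → (∀ x → hit x ≡ true → proj₁ (headI x) ≢ lit (8 + r))
    → ∀ x → hit x ≡ true → keep x ≡ true
  kept hit avoids x h with keep x in kx
  ... | true  = refl
  ... | false = ⊥-elim (avoids x h (removed x kx))

tidy-install : ∀ {r p} s₀ r′ α y → Tidy (suc r) p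
  → Tidy (suc r) (installJ (9 + r) (std (lit (8 + r)) s₀ r′ α y) p)
tidy-install {r} s₀ r′ α y tidy =
  tidy-append (basic (std (lit (8 + r)) s₀ r′ α y)) refl (tidy-filter _ replaced tidy)
  where
  replaced : ∀ x → not (concreteMatch (8 + r) s₀ x) ≡ false → proj₁ (headI x) ≡ lit (8 + r)
  replaced x e with concreteMatch (8 + r) s₀ x in hit
  replaced x e  | true = concrete-head (8 + r) s₀ x hit
  replaced x () | false

agree-letter : ∀ {n T} k → AgreesWithInput n T → 1 ≤ k → k ≤ n → T (+ k) ≡ 𝐚
agree-letter {n} k agree 1≤k k≤n = trans (agree (+ k)) (input-letter n k 1≤k k≤n)

agree-blank : ∀ {n T} k → AgreesWithInput n T → n < k → T (+ k) ≡ ♯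
agree-blank {n} k agree n<k = trans (agree (+ k)) (input-blank n k n<k)

verdict-continues : ∀ b → (verdict b ≡ᵇ hState) ≡ false
verdict-continues false = refl
verdict-continues true  = refl

verdict-halts : ∀ n b bits {r} N p T u → Tidy r p → AgreesWithInput n T
  → Halts bits (config N p (verdict b) T (+ (suc n + 1)) u) (Output n (verdictSym b))
verdict-halts n false bits N p T u tidy agree =
  halts-at-step (step-concrete bits (config N p sn T (+ (suc n + 1)) u) ♯ _
                  (agree-blank _ agree (NP.m≤m+n (suc n) 1)) (tidy .below sn ♯ (lit<8 sn _)))
    refl (output-written n 𝐍 T agree (if hState ≡ᵇ N then suc N else N) p hState (+ (suc n + 1)) u)
verdict-halts n true bits N p T u tidy agree =
  halts-at-step (step-concrete bits (config N p sy T (+ (suc n + 1)) u) ♯ _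
                  (agree-blank _ agree (NP.m≤m+n (suc n) 1)) (tidy .below sy ♯ (lit<8 sy _)))
    refl (output-written n 𝐘 T agree (if hState ≡ᵇ N then suc N else N) p hState (+ (suc n + 1)) u)

module Prefix {m} (as : Vec Bool (suc m)) (n : ℕ) (bits : ℕ → Bool) (Q : Config → Set) where

  From : ℕ → Set
  From j = ∀ T u → AgreesWithInput n T
    → Halts bits (config (10 + m) (initialProgram as) (8 + j) T (+ suc j) u) Q

  start : From 0 → Halts bits (initial (𝔔 m as) n) Q
  start from0 =
    halts-after-step (step-concrete bits (initial (𝔔 m as) n) ♯ _ refl
                       (findᵇ-++-just (concreteMatch 0 ♯) 𝓑 (prefixInstrs 0 as) refl)) refl
      (halts-cong _ no-new-state refl refl (from0 _ 0 (agree-write (+ 0) ♯ (λ _ → refl) refl)))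
    where
    no-new-state : (if 8 ≡ᵇ m + 10 then suc (m + 10) else m + 10) ≡ 10 + m
    no-new-state = trans (if-false (≢⇒≡ᵇ-false (NP.<⇒≢ (NP.<-≤-trans (s≤s (NP.m≤m+n 8 1)) (NP.m≤n+m 10 m)))))
                   (NP.+-comm m 10)

  cell : ∀ j → j < suc m → j < n → From (suc j) → From j
  cell j j≤m j<n next T u agree =
    halts-after-step (step-concrete bits (config (10 + m) (initialProgram as) (8 + j) T (+ suc j) u) 𝐚 _
                       (agree-letter (suc j) agree (s≤s z≤n) j<n) stored) refl
      (halts-cong _ no-new-state refl (cong +_ (NP.+-comm (suc j) 1))
        (next _ u (agree-write (+ suc j) 𝐚 agree (input-letter n (suc j) (s≤s z≤n) j<n))))
    where
    stored : lookupC (8 + j) 𝐚 (initialProgram as) ≡ just (basic (std (lit (j + 8)) 𝐚 (lit (9 + j)) 𝐚 R))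
    stored = trans (findᵇ-++-left (concreteMatch (8 + j) 𝐚) 𝓑 (prefixInstrs 0 as) (𝓑-silent j 𝐚))
                   (prefix-letter 0 as j j≤m)
    no-new-state : (if 9 + j ≡ᵇ 10 + m then suc (10 + m) else 10 + m) ≡ 10 + m
    no-new-state = if-false (≢⇒≡ᵇ-false {9 + j} {10 + m} (λ e → NP.<⇒≢ j≤m (cong (_∸ 9) e)))

  walk : ∀ e → e ≤ suc m → e ≤ n → From e → From 0
  walk e e≤m e≤n from-e = descend From
    (λ j j<e → cell j (NP.<-≤-trans j<e e≤m) (NP.<-≤-trans j<e e≤n)) from-e 0 z≤n

prefix-verdict : ∀ {m} (as : Vec Bool (suc m)) (i : Fin (suc m)) b → lookup as i ≡ b → ∀ bits
  → Prefix.From as (toℕ i) bits (Output (toℕ i) (verdictSym b)) (toℕ i)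
prefix-verdict {m} as i b aᵢ bits T u agree =
  halts-after-step (step-concrete bits (config (10 + m) (initialProgram as) (8 + n) T (+ suc n) u) ♯ _
                     (agree-blank (suc n) agree NP.≤-refl) stored) (verdict-continues b)
    (verdict-halts n b bits _ (initialProgram as) _ u (tidy-initial as)
      (agree-write (+ suc n) ♯ agree (input-blank n (suc n) NP.≤-refl)))
  where
  n : ℕ
  n = toℕ i
  stored : lookupC (8 + n) ♯ (initialProgram as) ≡ just (basic (std (lit (n + 8)) ♯ (lit (verdict b)) ♯ R))
  stored = trans (findᵇ-++-left (concreteMatch (8 + n) ♯) 𝓑 (prefixInstrs 0 as) (𝓑-silent n ♯))
                 (prefix-blank 0 as i b aᵢ)

-- The random phase on aⁿ, with every measured bit equal to b.  `From b j`: from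
-- state 8 + j = |Q| - 1 on square j + 1, with a tidy program, the machine halts
-- with the verdict selected by b.

module Random (n : ℕ) where

  From : Bool → ℕ → Set
  From b j = ∀ T u p → AgreesWithInput n T → Tidy j p
    → Halts (λ _ → b) (config (9 + j) p (8 + j) T (+ suc j) u) (Output n (verdictSym b))

  -- on a letter: the simple meta instruction leads to x, a bit is measured in
  -- state t, stored as the verdict of state 8 + j for the blank, and w creates
  -- the new state 9 + j = |Q| - 1 for the next square
  cell : ∀ b j → j < n → From b (suc j) → From b j
  cell b j j<n next T u p agree tidy =
    halts-after-step (step-symbolic bits (config (9 + j) p (8 + j) T P u) 𝐚 _ letter
                       (tidy .above j 𝐚 NP.≤-refl)
                       (trans (tidy .symbolic (9 + j) (8 + j) 𝐚) (𝓑-simple-letter j))) refl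
    (halts-after-step (step-concrete bits (config (9 + j) p₁ sx T₁ P u) 𝐚 _
                        (write-here T P 𝐚) (tidy₁ .below sx 𝐚 (lit<8 sx _))) refl
    (halts-after-step (step-concrete bits (config (9 + j) p₁ st' T₂ P (suc u)) (bitSym b) _
                        (write-here T₁ P (bitSym b))
                        (trans (tidy₁ .below st' (bitSym b) (lit<8 st' _)) (𝓑-t-on-bit b))) refl
    (halts-after-step (step-concrete bits (config (9 + j) p₃ sw T₃ P (suc u)) 𝐚 _
                        (write-here T₂ P 𝐚) (tidy₃ .below sw 𝐚 (lit<8 sw _))) refl
    (halts-cong _ (if-true (≡ᵇ-refl (9 + j))) refl (cong +_ (NP.+-comm (suc j) 1))
      (next _ (suc u) _ (agree-write P 𝐚 agree₃ input)
            (tidy-install 𝐚 (lit (9 + j)) 𝐚 R tidy₃))))))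
    where
    bits : ℕ → Bool
    bits _ = b
    P : ℤ
    P = + suc j
    input : inputTape n P ≡ 𝐚
    input = input-letter n (suc j) (s≤s z≤n) j<n
    letter : T P ≡ 𝐚
    letter = agree-letter (suc j) agree (s≤s z≤n) j<n
    T₁ : ℤ → Sym
    T₁ = write T P 𝐚
    T₂ : ℤ → Sym
    T₂ = write T₁ P (bitSym b)
    T₃ : ℤ → Sym
    T₃ = write T₂ P 𝐚
    agree₃ : AgreesWithInput n T₃
    agree₃ = agree-overwrite P (bitSym b) 𝐚 (agree-write P 𝐚 agree input) input
    p₁ : List Instr
    p₁ = p ++ basic (std (lit (8 + j)) 𝐚 (lit sx) 𝐚 S) ∷ []
    tidy₁ : Tidy (suc j) p₁
    tidy₁ = tidy-append _ refl (tidy-weaken tidy)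
    p₃ : List Instr
    p₃ = installJ (9 + j) (std (lit (8 + j)) ♯ (lit (verdict b)) ♯ R) p₁
    tidy₃ : Tidy (suc j) p₃
    tidy₃ = tidy-install ♯ (lit (verdict b)) ♯ R tidy₁

  -- after the bit b has been measured on the blank square n + 1: x stores the
  -- verdict of b, v (b = false) or w (b = true) moves on to the verdict state
  settle : ∀ b T u p → AgreesWithInput n T → Tidy (suc n) p
    → Halts (λ _ → b) (config (9 + n) p sx (write T (+ suc n) (bitSym b)) (+ suc n) u)
            (Output n (verdictSym b))
  settle false T u p agree tidy =
    halts-after-step (step-concrete bits (config (9 + n) p sx T₂ P u) 𝟎 _
                       (write-here T P 𝟎) (tidy .below sx 𝟎 (lit<8 sx _))) refl
    (halts-after-step (step-concrete bits (config (9 + n) p₃ sv T₃ P u) ♯ _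
                        (write-here T₂ P ♯) (tidy₃ .below sv ♯ (lit<8 sv _))) refl
    (verdict-halts n false bits _ _ _ u (tidy-install 𝐚 (lit (9 + n)) 𝐚 R tidy₃)
      (agree-write P ♯ (agree-overwrite P 𝟎 ♯ agree input) input)))
    where
    bits : ℕ → Bool
    bits _ = false
    P : ℤ
    P = + suc n
    input : inputTape n P ≡ ♯
    input = input-blank n (suc n) NP.≤-refl
    T₂ : ℤ → Sym
    T₂ = write T P 𝟎
    T₃ : ℤ → Sym
    T₃ = write T₂ P ♯
    p₃ : List Instr
    p₃ = installJ (9 + n) (std (lit (8 + n)) ♯ (lit sn) ♯ R) p
    tidy₃ : Tidy (suc n) p₃
    tidy₃ = tidy-install ♯ (lit sn) ♯ R tidy
  settle true T u p agree tidy =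
    halts-after-step (step-concrete bits (config (9 + n) p sx T₂ P u) 𝟏 _
                       (write-here T P 𝟏) (tidy .below sx 𝟏 (lit<8 sx _))) refl
    (halts-after-step (step-concrete bits (config (9 + n) p₃ sw T₃ P u) ♯ _
                        (write-here T₂ P ♯) (tidy₃ .below sw ♯ (lit<8 sw _))) refl
    (verdict-halts n true bits _ _ _ u (tidy-install 𝐚 (lit (9 + n)) 𝐚 R tidy₃)
      (agree-write P ♯ (agree-overwrite P 𝟏 ♯ agree input) input)))
    where
    bits : ℕ → Bool
    bits _ = true
    P : ℤ
    P = + suc n
    input : inputTape n P ≡ ♯
    input = input-blank n (suc n) NP.≤-refl
    T₂ : ℤ → Sym
    T₂ = write T P 𝟏
    T₃ : ℤ → Sym
    T₃ = write T₂ P ♯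
    p₃ : List Instr
    p₃ = installJ (9 + n) (std (lit (8 + n)) ♯ (lit sy) ♯ R) p
    tidy₃ : Tidy (suc n) p₃
    tidy₃ = tidy-install ♯ (lit sy) ♯ R tidy

  -- on the blank square n + 1: the simple meta instruction leads to x, which
  -- measures the deciding bit
  end : ∀ b → From b n
  end b T u p agree tidy =
    halts-after-step (step-symbolic bits (config (9 + n) p (8 + n) T P u) ♯ _
                       (agree-blank (suc n) agree NP.≤-refl)
                       (tidy .above n ♯ NP.≤-refl)
                       (trans (tidy .symbolic (9 + n) (8 + n) ♯) (𝓑-simple-blank n))) refl
    (halts-after-step (step-concrete bits (config (9 + n) p₁ sx (write T P ♯) P u) ♯ _
                        (write-here T P ♯) (tidy₁ .below sx ♯ (lit<8 sx _))) refl
    (settle b (write T P ♯) (suc u) p₁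
      (agree-write P ♯ agree (input-blank n (suc n) NP.≤-refl)) tidy₁))
    where
    bits : ℕ → Bool
    bits _ = b
    P : ℤ
    P = + suc n
    p₁ : List Instr
    p₁ = p ++ basic (std (lit (8 + n)) ♯ (lit sx) ♯ S) ∷ []
    tidy₁ : Tidy (suc n) p₁
    tidy₁ = tidy-append _ refl (tidy-weaken tidy)

  sweep : ∀ b j → j ≤ n → From b j
  sweep b = descend (From b) (cell b) (end b)

determined : ∀ m (as : Vec Bool (suc m)) (i : Fin (suc m)) b → lookup as i ≡ b
  → ∀ bits → HaltsWith (verdictSym b) (𝔔 m as) (toℕ i) bits
determined m as i b aᵢ bits = halts-with (start (walk (toℕ i) i≤m NP.≤-refl (prefix-verdict as i b aᵢ bits)))
  where
  open Prefix as (toℕ i) bits (Output (toℕ i) (verdictSym b))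
  i≤m : toℕ i ≤ suc m
  i≤m = NP.<⇒≤ (FinP.toℕ<n i)

undetermined : ∀ m (as : Vec Bool (suc m)) n → m < n
  → ∀ b → HaltsWith (verdictSym b) (𝔔 m as) n (λ _ → b)
undetermined m as n m<n b =
  halts-with (start (walk (suc m) NP.≤-refl m<n
    (λ T u agree → Random.sweep n b (suc m) m<n T u (initialProgram as) agree (tidy-initial as))))
  where open Prefix as n (λ _ → b) (Output n (verdictSym b))

mainTheorem1 : (m : ℕ) (as : Vec Bool (suc m)) →
    ((i : Fin (suc m)) →
        (lookup as i ≡ true → (bits : ℕ → Bool) → InLanguage (𝔔 m as) (toℕ i) bits)
      × (lookup as i ≡ false → (bits : ℕ → Bool) → NotInLanguage (𝔔 m as) (toℕ i) bits))
    × ((n : ℕ) → m < n →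
        Σ (ℕ → Bool) (λ bits → InLanguage (𝔔 m as) n bits)
      × Σ (ℕ → Bool) (λ bits → NotInLanguage (𝔔 m as) n bits))
mainTheorem1 m as =
    (λ i → determined m as i true , determined m as i false)
  , λ n m<n → ((λ _ → true) , undetermined m as n m<n true)
            , ((λ _ → false) , undetermined m as n m<n false)
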